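{- Let $a_1\geq\cdots\geq a_n$, $b_1\geq\cdots\geq b_m$, $\nu$, $k$ be nonnegative integers with $k\leq \nu\leq\min\{n,m\}$, and let $N=N(d_A,d_B,\nu,k)$ where $(d_A,d_B)=((a_1,\ldots,a_n),(b_1,\ldots,b_m))$. Then some $s$-$t$-cut in $N$ of minimum capacity is clean.
   Context: $[k]=\{1,\ldots,k\}$. The network $N(d_A,d_B,\nu,k)=(D,c)$: $D$ is the digraph with vertex set $\{s\}\cup\{v_1,\ldots,v_n\}\cup\{w_1,\ldots,w_m\}\cup\{t\}$ and arcs $(s,v_i)$ for all $i\in[n]$; $(v_i,w_j)$ for all $(i,j)\in[n]\times[m]$ except those with ($i>k$ and $j>\nu-k$) or $i+j=\nu+1$; and $(w_j,t)$ for all $j\in[m]$. Capacities: $c((s,v_i))=a_i-1$ for $i\in[k]$, $a_i$ for $i\in[n]\setminus[k]$; $c((w_j,t))=b_j-1$ for $j\in[\nu-k]$, $b_j$ for $j\in[m]\setminus[\nu-k]$; $c((v_i,w_j))=1$. An $s$-$t$-cut generated by a vertex set $X$ with $s\in X$, $t\notin X$ is the set of arcs from $X$ to its complement; its capacity is the sum of their capacities. Write $X=\{s\}\cup S_1\cup S_2\cup T_1\cup T_2$ with $S_1\subseteq\{v_1,\ldots,v_k\}$, $S_2\subseteq\{v_{k+1},\ldots,v_n\}$, $T_1\subseteq\{w_1,\ldots,w_{\nu-k}\}$, $T_2\subseteq\{w_{\nu-k+1},\ldots,w_m\}$. The cut is clean if: (1) if $v_i\in S_1$ and $v_j\in\{v_1,\ldots,v_k\}\setminus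 S_1$ then $a_i\geq a_j$; (2) if $w_i\in T_1$ and $w_j\in\{w_1,\ldots,w_{\nu-k}\}\setminus T_1$ then $b_i\leq b_j$; (3) if $v_i\in S_2$ and $v_j\in\{v_{k+1},\ldots,v_n\}\setminus S_2$ then $a_i\geq a_j$; (4) if $w_i\in T_2$ and $w_j\in\{w_{\nu-k+1},\ldots,w_m\}\setminus T_2$ then $b_i\leq b_j$; (5) if $v_i\in S_1$, $v_j\in\{v_1,\ldots,v_k\}\setminus S_1$ and $a_i=a_j$, then $i>j$; (6) if $v_i\in S_2$, $v_j\in\{v_{k+1},\ldots,v_n\}\setminus S_2$ and $a_i=a_j$, then $i>j$. -}

module Defs where

open import Data.Nat as ℕ using (ℕ; suc; _≤_; _<_; _>_)
open import Data.Integer as ℤ using (ℤ; +_)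
open import Data.Fin using (Fin; toℕ)
open import Data.List using (List; []; _∷_; _++_; map; allFin; foldr)
open import Data.Bool using (Bool; true; false; if_then_else_; _∧_; _∨_; not; T)
open import Data.Product using (_×_; Σ; _,_)
open import Relation.Binary.PropositionalEquality using (_≡_)

ix : {n : ℕ} → Fin n → ℕ
ix i = suc (toℕ i)

data V (n m : ℕ) : Set where
  s : V n m
  v : Fin n → V n m
  w : Fin m → V n m
  t : V n m

vertices : (n m : ℕ) → List (V n m)
vertices n m = s ∷ (map v (allFin n) ++ (map w (allFin m) ++ (t ∷ [])))

-- Parameters of N(d_A,d_B,ν,k): a : Fin n → ℕ (a_i = a (i-1)), b, ν, k.
-- Arc relation of D (as a Boolean).
arc : {n m : ℕ} (ν k : ℕ) → V n m → V n m → Bool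
arc ν k s (v i) = true
arc ν k (v i) (w j) =
  not (((k ℕ.<ᵇ ix i) ∧ ((ν ℕ.∸ k) ℕ.<ᵇ ix j)) ∨ ((ix i ℕ.+ ix j) ℕ.≡ᵇ suc ν))
arc ν k (w j) t = true
arc ν k _ _ = false

-- Capacities (integer-valued, taken literally: a_i - 1 etc.)
cap : {n m : ℕ} (a : Fin n → ℕ) (b : Fin m → ℕ) (ν k : ℕ) → V n m → V n m → ℤ
cap a b ν k s (v i) = if ix i ℕ.≤ᵇ k then + a i ℤ.- ℤ.1ℤ else + a i
cap a b ν k (v i) (w j) = ℤ.1ℤ
cap a b ν k (w j) t = if ix j ℕ.≤ᵇ (ν ℕ.∸ k) then + b j ℤ.- ℤ.1ℤ else + b j
cap a b ν k _ _ = ℤ.0ℤ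

sumℤ : List ℤ → ℤ
sumℤ = foldr ℤ._+_ ℤ.0ℤ

IsSTSet : {n m : ℕ} → (V n m → Bool) → Set
IsSTSet X = (X s ≡ true) × (X t ≡ false)

cutCap : {n m : ℕ} (a : Fin n → ℕ) (b : Fin m → ℕ) (ν k : ℕ) → (V n m → Bool) → ℤ
cutCap {n} {m} a b ν k X =
  sumℤ (map (λ x → sumℤ (map (λ y →
      if arc ν k x y ∧ X x ∧ not (X y) then cap a b ν k x y else ℤ.0ℤ)
    (vertices n m))) (vertices n m))

Clean : {n m : ℕ} (a : Fin n → ℕ) (b : Fin m → ℕ) (ν k : ℕ) → (V n m → Bool) → Set
Clean {n} {m} a b ν k X =
  (∀ (i j : Fin n) → ix i ≤ k → ix j ≤ k → T (X (v i)) → T (not (X (v j))) →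
     (a j ≤ a i) × (a i ≡ a j → ix i > ix j)) ×
  (∀ (i j : Fin m) → ix i ≤ ν ℕ.∸ k → ix j ≤ ν ℕ.∸ k → T (X (w i)) → T (not (X (w j))) →
     b i ≤ b j) ×
  (∀ (i j : Fin n) → k < ix i → k < ix j → T (X (v i)) → T (not (X (v j))) →
     (a j ≤ a i) × (a i ≡ a j → ix i > ix j)) ×
  (∀ (i j : Fin m) → ν ℕ.∸ k < ix i → ν ℕ.∸ k < ix j → T (X (w i)) → T (not (X (w j))) →
     b i ≤ b j)

NonIncreasing : {n : ℕ} → (Fin n → ℕ) → Set
NonIncreasing {n} f = ∀ (i j : Fin n) → toℕ i ≤ toℕ j → f j ≤ f i

-- Among all cuts {s} ∪ S ∪ T choose one minimising, lexicographically, its capacity followed by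
-- the tie-breakers Φ S, Σ_{v_i ∉ S} a_i, Σ_{v_i ∉ S} i and Σ_{w_j ∉ T} j; it is in particular a
-- minimum cut. Within a block the capacities of the arcs s v_i differ exactly as the a_i (likewise
-- for the arcs w_j t), and two vertices v_i, v_j of a block have the same neighbours except for
-- their anti-diagonal partners w_{ν+1-i} and w_{ν+1-j}. Hence exchanging a pair that violates
-- cleanliness never increases the capacity, and when it keeps it, it lowers a tie-breaker. A tie
-- a_i = a_j with i < j ≤ ν may require exchanging the two partners as well.

module Submission where

open import Defs

open import Data.Bool using (Bool; true; false; not; _∧_; _∨_; _xor_; if_then_else_)
import Data.Bool.Properties as 𝔹
open import Data.Fin using (Fin; zero; suc; punchIn; fromℕ<; _↑ˡ_; _↑ʳ_; splitAt)
import Data.Fin.Properties as FinP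
open import Data.Integer as ℤ using (ℤ; +_; _+_; _-_; -_; _≤_; _<_; 0ℤ; 1ℤ; -1ℤ)
import Data.Integer.Properties as ℤP
open import Data.Integer.Tactic.RingSolver using (solve-∀)
open import Data.Nat as ℕ using (ℕ; zero; suc; _∸_)
import Data.Nat.Properties as ℕP
open import Data.Vec using (Vec; []; _∷_)
open import Data.Vec.Relation.Binary.Lex.Strict as Lex using (Lex-<; this; next)
import Data.Vec.Relation.Binary.Pointwise.Inductive as Pointwise
open import Data.Sum using ([_,_]′)
open import Data.Product using (Σ; Σ-syntax; _×_; _,_; proj₁; proj₂)
import Data.Vec.Functional as Vector
open import Data.Vec.Functional using (updateAt)
open import Data.Vec.Functional.Properties using (updateAt-updates; updateAt-minimal)
open import Data.List using ([]; _∷_; _++_; map; tabulate; allFin)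
import Data.List.Properties as ListP
open import Function using (_∘_; const; id)
open import Function.Bundles using (Equivalence)
open import Relation.Binary.Bundles using (StrictTotalOrder)
open import Relation.Binary.Definitions using (tri<; tri≈; tri>)
open import Relation.Binary.PropositionalEquality
open import Relation.Nullary using (¬_; contradiction; yes; no)

open import Algebra.Properties.CommutativeMonoid.Sum ℤP.+-0-commutativeMonoid
  using (sum; sum-syntax; sum-cong-≗; sum-replicate-zero; sum-remove; ∑-distrib-+; ∑-comm)

-- Integer arithmetic and finite sums

⟦_⟧ : Bool → ℤ
⟦ x ⟧ = if x then 1ℤ else 0ℤ

0≤⟦⟧ : ∀ x → 0ℤ ≤ ⟦ x ⟧
0≤⟦⟧ true  = ℤ.+≤+ ℕ.z≤n
0≤⟦⟧ false = ℤ.+≤+ ℕ.z≤n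

∑-mono-≤ : ∀ {r} {f g : Fin r → ℤ} → (∀ i → f i ≤ g i) → sum f ≤ sum g
∑-mono-≤ {zero}  _   = ℤP.≤-refl
∑-mono-≤ {suc r} f≤g = ℤP.+-mono-≤ (f≤g zero) (∑-mono-≤ (f≤g ∘ suc))

∑-zero : ∀ {r} {f : Fin r → ℤ} → (∀ i → f i ≡ 0ℤ) → sum f ≡ 0ℤ
∑-zero {r} f≡0 = trans (sum-cong-≗ {y = const 0ℤ} f≡0) (sum-replicate-zero r)

0≤∑⟦⟧ : ∀ {r} (P : Fin r → Bool) → 0ℤ ≤ ∑[ i < r ] ⟦ P i ⟧
0≤∑⟦⟧ {r} P = subst (_≤ ∑[ i < r ] ⟦ P i ⟧) (∑-zero {r} (λ _ → refl)) (∑-mono-≤ (0≤⟦⟧ ∘ P))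

∑-agree-off : ∀ {r} (f g : Fin r → ℤ) i → (∀ j → j ≢ i → f j ≡ g j) → sum f + g i ≡ sum g + f i
∑-agree-off {suc r} f g i agree = begin
  sum f + g i                       ≡⟨ cong (_+ g i) (sum-remove {i = i} f) ⟩
  f i + sum (f ∘ punchIn i) + g i   ≡⟨ cong (λ x → f i + x + g i) (sum-cong-≗ (agree _ ∘ FinP.punchInᵢ≢i i)) ⟩
  f i + sum (g ∘ punchIn i) + g i   ≡⟨ swap-outer (f i) (sum (g ∘ punchIn i)) (g i) ⟩
  g i + sum (g ∘ punchIn i) + f i   ≡⟨ cong (_+ f i) (sum-remove {i = i} g) ⟨
  sum g + f i                       ∎
  where
  open ≡-Reasoning
  swap-outer : ∀ x y z → x + y + z ≡ z + y + x
  swap-outer = solve-∀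

∑-single : ∀ {r} (f : Fin r → ℤ) i → (∀ j → j ≢ i → f j ≡ 0ℤ) → sum f ≡ f i
∑-single {r} f i off = begin
  sum f                   ≡⟨ ℤP.+-identityʳ (sum f) ⟨
  sum f + 0ℤ              ≡⟨ ∑-agree-off f (const 0ℤ) i off ⟩
  ∑[ _ < r ] 0ℤ + f i     ≡⟨ cong (_+ f i) (∑-zero {r} (λ _ → refl)) ⟩
  0ℤ + f i                ≡⟨ ℤP.+-identityˡ (f i) ⟩
  f i                     ∎
  where open ≡-Reasoning

∑-⟦⟧-≤1 : ∀ {r} (P : Fin r → Bool) → (∀ i j → P i ≡ true → P j ≡ true → i ≡ j) →
          ∑[ i < r ] ⟦ P i ⟧ ≤ 1ℤ
∑-⟦⟧-≤1 {zero}  P unique = ℤ.+≤+ ℕ.z≤n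
∑-⟦⟧-≤1 {suc r} P unique with P zero in P₀
... | true  = ℤP.≤-reflexive
  (cong (_+_ 1ℤ) (∑-zero {r} (λ i → cong ⟦_⟧ (𝔹.¬-not (FinP.0≢1+n ∘ unique _ _ P₀)))))
... | false = subst (_≤ 1ℤ) (sym (ℤP.+-identityˡ _))
                (∑-⟦⟧-≤1 (P ∘ suc) (λ i j Pᵢ Pⱼ → FinP.suc-injective (unique _ _ Pᵢ Pⱼ)))

≤-balance : ∀ {x y u u′ : ℤ} → x + u ≡ y + u′ → u′ ≤ u → x ≤ y
≤-balance {x} {y} {u} {u′} eq u′≤u = begin
  x             ≡⟨ add-sub x u ⟩
  (x + u) - u   ≡⟨ cong (_- u) eq ⟩
  (y + u′) - u  ≤⟨ ℤP.+-monoˡ-≤ (- u) (ℤP.+-monoʳ-≤ y u′≤u) ⟩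
  (y + u) - u   ≡⟨ add-sub y u ⟨
  y             ∎
  where
  open ℤP.≤-Reasoning
  add-sub : ∀ x u → x ≡ (x + u) - u
  add-sub = solve-∀

<-balance : ∀ {x y u u′ : ℤ} → x + u ≡ y + u′ → u′ < u → x < y
<-balance {x} {y} {u} {u′} eq u′<u = begin-strict
  x             ≡⟨ add-sub x u ⟩
  (x + u) - u   ≡⟨ cong (_- u) eq ⟩
  (y + u′) - u  <⟨ ℤP.+-monoˡ-< (- u) (ℤP.+-monoʳ-< y u′<u) ⟩
  (y + u) - u   ≡⟨ add-sub y u ⟨
  y             ∎
  where
  open ℤP.≤-Reasoning
  add-sub : ∀ x u → x ≡ (x + u) - u
  add-sub = solve-∀

≡-balance : ∀ {x y u u′ c : ℤ} → x + u ≡ y + u′ → u′ ≡ u + c → x ≡ y + c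
≡-balance {x} {y} {u} {c = c} eq refl = begin
  x                   ≡⟨ add-sub x u ⟩
  (x + u) - u         ≡⟨ cong (_- u) eq ⟩
  (y + (u + c)) - u   ≡⟨ cancel y u c ⟩
  y + c               ∎
  where
  open ≡-Reasoning
  add-sub : ∀ x u → x ≡ (x + u) - u
  add-sub = solve-∀
  cancel : ∀ y u c → (y + (u + c)) - u ≡ y + c
  cancel = solve-∀

cross-≤ : ∀ {x y u z : ℤ} → y ≤ x + 1ℤ → u + 1ℤ ≤ z → u + y ≤ x + z
cross-≤ {x} {y} {u} {z} y≤x+1 u+1≤z = begin
  u + y            ≤⟨ ℤP.+-monoʳ-≤ u y≤x+1 ⟩
  u + (x + 1ℤ)     ≡⟨ shuffle u x ⟩
  x + (u + 1ℤ)     ≤⟨ ℤP.+-monoʳ-≤ x u+1≤z ⟩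
  x + z            ∎
  where
  open ℤP.≤-Reasoning
  shuffle : ∀ u x → u + (x + 1ℤ) ≡ x + (u + 1ℤ)
  shuffle = solve-∀

cross-< : ∀ {x y u z : ℤ} → y ≤ x → u + 1ℤ ≤ z → u + y < x + z
cross-< {x} {y} {u} {z} y≤x u+1≤z = ℤP.suc[i]≤j⇒i<j (begin
  1ℤ + (u + y)     ≡⟨ shuffle u y ⟩
  u + 1ℤ + y       ≤⟨ ℤP.+-mono-≤ u+1≤z y≤x ⟩
  z + x            ≡⟨ ℤP.+-comm z x ⟩
  x + z            ∎)
  where
  open ℤP.≤-Reasoning
  shuffle : ∀ u y → 1ℤ + (u + y) ≡ u + 1ℤ + y
  shuffle = solve-∀

≤-then : ∀ {p} {x y : ℤ} {xs ys : Vec ℤ p} → x ≤ y → (x ≡ y → Lex-< _≡_ _<_ xs ys) →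
         Lex-< _≡_ _<_ (x ∷ xs) (y ∷ ys)
≤-then {x = x} {y} x≤y rest with x ℤP.≟ y
... | yes x≡y = next x≡y (rest x≡y)
... | no  x≢y = this (ℤP.≤∧≢⇒< x≤y x≢y) refl

-- Additive functionals of Boolean vectors

Additive : ∀ {r} → ((Fin r → Bool) → ℤ) → (Bool → Fin r → ℤ) → Set
Additive Ψ f = ∀ S i c → Ψ (updateAt S i (const c)) + f (S i) i ≡ Ψ S + f c i

∑-additive : ∀ {r} (f : Bool → Fin r → ℤ) → Additive (λ S → ∑[ i < r ] f (S i) i) f
∑-additive {r} f S i c = trans
  (∑-agree-off _ _ i (λ j j≢i → cong (λ x → f x j) (updateAt-minimal j i S j≢i)))
  (cong (λ x → ∑[ j < r ] f (S j) j + f x i) (updateAt-updates i S))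

additive-+ : ∀ {r} {Ψ Φ : (Fin r → Bool) → ℤ} {f} (c : ℤ) → Additive Ψ f → (∀ S → Φ S ≡ Ψ S + c) →
             Additive Φ f
additive-+ {Ψ = Ψ} {Φ} {f} c Ψ-add Φ≡Ψ+c S i x = begin
  Φ (updateAt S i (const x)) + f (S i) i        ≡⟨ cong (_+ f (S i) i) (Φ≡Ψ+c (updateAt S i (const x))) ⟩
  Ψ (updateAt S i (const x)) + c + f (S i) i    ≡⟨ move-c (Ψ (updateAt S i (const x))) c (f (S i) i) ⟩
  Ψ (updateAt S i (const x)) + f (S i) i + c    ≡⟨ cong (_+ c) (Ψ-add S i x) ⟩
  Ψ S + f x i + c                               ≡⟨ move-c (Ψ S) c (f x i) ⟨
  Ψ S + c + f x i                               ≡⟨ cong (_+ f x i) (Φ≡Ψ+c S) ⟨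
  Φ S + f x i                                   ∎
  where
  open ≡-Reasoning
  move-c : ∀ y c z → y + c + z ≡ y + z + c
  move-c = solve-∀

exchange : ∀ {r} → (Fin r → Bool) → Fin r → Fin r → (Fin r → Bool)
exchange S i j = updateAt (updateAt S i (const false)) j (const true)

exchange-distinct : ∀ {r} {S : Fin r → Bool} {i j} → S i ≡ true → S j ≡ false → i ≢ j
exchange-distinct Sᵢ Sⱼ refl = 𝔹.not-¬ Sᵢ Sⱼ

exchange-additive : ∀ {r} {Ψ : (Fin r → Bool) → ℤ} {f} → Additive Ψ f →
                    ∀ {S i j} → S i ≡ true → S j ≡ false →
                    Ψ (exchange S i j) + (f true i + f false j) ≡ Ψ S + (f false i + f true j)
exchange-additive {r} {Ψ} {f} Ψ-add {S} {i} {j} Sᵢ Sⱼ = begin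
  Ψ (exchange S i j) + (f true i + f false j)    ≡⟨ shuffle (Ψ (exchange S i j)) (f true i) (f false j) ⟩
  Ψ (exchange S i j) + f false j + f true i      ≡⟨ cong₂ (λ x y → Ψ (exchange S i j) + f x j + f y i) Uⱼ≡false Sᵢ ⟨
  Ψ (exchange S i j) + f (U j) j + f (S i) i     ≡⟨ cong (_+ f (S i) i) (Ψ-add U j true) ⟩
  Ψ U + f true j + f (S i) i                     ≡⟨ swap-last (Ψ U) (f true j) (f (S i) i) ⟩
  Ψ U + f (S i) i + f true j                     ≡⟨ cong (_+ f true j) (Ψ-add S i false) ⟩
  Ψ S + f false i + f true j                     ≡⟨ ℤP.+-assoc (Ψ S) (f false i) (f true j) ⟩
  Ψ S + (f false i + f true j)                   ∎
  where
  open ≡-Reasoning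
  U : Fin r → Bool
  U = updateAt S i (const false)
  Uⱼ≡false : U j ≡ false
  Uⱼ≡false = trans (updateAt-minimal j i S (exchange-distinct Sᵢ Sⱼ ∘ sym)) Sⱼ
  shuffle : ∀ x y z → x + (y + z) ≡ x + z + y
  shuffle = solve-∀
  swap-last : ∀ x y z → x + y + z ≡ x + z + y
  swap-last = solve-∀

exchange-invariant : ∀ {r} {Ψ : (Fin r → Bool) → ℤ} {f} → Additive Ψ f →
                     ∀ {S i j} → S i ≡ true → S j ≡ false →
                     (∀ x → f x i ≡ f x j) → Ψ (exchange S i j) ≡ Ψ S
exchange-invariant {Ψ = Ψ} {f} Ψ-add {S} {i} {j} Sᵢ Sⱼ fᵢ≡fⱼ = trans
  (≡-balance {y = Ψ S} {c = 0ℤ} (exchange-additive {Ψ = Ψ} Ψ-add Sᵢ Sⱼ) (begin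
    f false i + f true j         ≡⟨ cong₂ _+_ (fᵢ≡fⱼ false) (sym (fᵢ≡fⱼ true)) ⟩
    f false j + f true i         ≡⟨ ℤP.+-comm (f false j) (f true i) ⟩
    f true i + f false j         ≡⟨ ℤP.+-identityʳ _ ⟨
    f true i + f false j + 0ℤ    ∎))
  (ℤP.+-identityʳ (Ψ S))
  where open ≡-Reasoning

exchange-out : ∀ {r} (S : Fin r → Bool) {i j} → i ≢ j → exchange S i j i ≡ false
exchange-out S {i} {j} i≢j = trans (updateAt-minimal i j _ i≢j) (updateAt-updates i S)

exchange-in : ∀ {r} (S : Fin r → Bool) i j → exchange S i j j ≡ true
exchange-in S i j = updateAt-updates j _

outside : ∀ {r} → (Fin r → ℕ) → Bool → Fin r → ℤ
outside f x i = if x then 0ℤ else + f i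

∑∉ : ∀ {r} → (Fin r → Bool) → (Fin r → ℕ) → ℤ
∑∉ {r} S f = ∑[ i < r ] outside f (S i) i

module _ {r} (S : Fin r → Bool) (f : Fin r → ℕ) {i j : Fin r} (Sᵢ : S i ≡ true) (Sⱼ : S j ≡ false) where

  ∑∉-exchange : ∑∉ (exchange S i j) f + + f j ≡ ∑∉ S f + + f i
  ∑∉-exchange = begin
    ∑∉ E f + + f j           ≡⟨ cong (_+_ (∑∉ E f)) (ℤP.+-identityˡ _) ⟨
    ∑∉ E f + (0ℤ + + f j)    ≡⟨ exchange-additive {Ψ = λ S → ∑∉ S f} (∑-additive (outside f)) Sᵢ Sⱼ ⟩
    ∑∉ S f + (+ f i + 0ℤ)    ≡⟨ cong (_+_ (∑∉ S f)) (ℤP.+-identityʳ _) ⟩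
    ∑∉ S f + + f i           ∎
    where
    open ≡-Reasoning
    E : Fin r → Bool
    E = exchange S i j

  ∑∉-exchange-< : f i ℕ.< f j → ∑∉ (exchange S i j) f < ∑∉ S f
  ∑∉-exchange-< fᵢ<fⱼ = <-balance ∑∉-exchange (ℤ.+<+ fᵢ<fⱼ)

  ∑∉-exchange-≡ : f i ≡ f j → ∑∉ (exchange S i j) f ≡ ∑∉ S f
  ∑∉-exchange-≡ fᵢ≡fⱼ = exchange-invariant {Ψ = λ S → ∑∉ S f} (∑-additive (outside f)) Sᵢ Sⱼ same
    where
    same : ∀ x → outside f x i ≡ outside f x j
    same true  = refl
    same false = cong +_ fᵢ≡fⱼ

-- Minimisers on Boolean cubes

module _ {c ℓ₁ ℓ₂} (O : StrictTotalOrder c ℓ₁ ℓ₂) where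
  open StrictTotalOrder O using (Carrier; _≈_; module Eq; compare; irrefl; <-respˡ-≈; <-respʳ-≈)
    renaming (_<_ to _≺_; trans to ≺-trans)

  private
    ≺-⊀-trans : ∀ {x y z} → x ≺ y → ¬ (z ≺ y) → x ≺ z
    ≺-⊀-trans {x} {y} {z} x<y z≮y with compare z y
    ... | tri< z<y _ _ = contradiction z<y z≮y
    ... | tri≈ _ z≈y _ = <-respʳ-≈ (Eq.sym z≈y) x<y
    ... | tri> _ _ y<z = ≺-trans x<y y<z

  minimiser : ∀ r (κ : (Fin r → Bool) → Carrier) → (∀ {X Y} → X ≗ Y → κ X ≈ κ Y) →
              Σ[ X ∈ (Fin r → Bool) ] (∀ Y → ¬ (κ Y ≺ κ X))
  minimiser zero κ κ-cong = (λ ()) , λ Y → irrefl (κ-cong (λ ()))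
  minimiser (suc r) κ κ-cong = best b* , λ Y → below-best Y b*-minimal
    where
    head-tail : ∀ (Y : Fin (suc r) → Bool) → Y ≗ (Y zero Vector.∷ Y ∘ suc)
    head-tail Y zero    = refl
    head-tail Y (suc i) = refl

    ∷-cong : ∀ b {X Y : Fin r → Bool} → X ≗ Y → (b Vector.∷ X) ≗ (b Vector.∷ Y)
    ∷-cong b X≗Y zero    = refl
    ∷-cong b X≗Y (suc i) = X≗Y i

    sub : ∀ b → Σ[ X ∈ (Fin r → Bool) ] (∀ Y → ¬ (κ (b Vector.∷ Y) ≺ κ (b Vector.∷ X)))
    sub b = minimiser r (κ ∘ (b Vector.∷_)) (κ-cong ∘ ∷-cong b)

    best : Bool → Fin (suc r) → Bool
    best b = b Vector.∷ proj₁ (sub b)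

    b* : Bool
    b* with compare (κ (best true)) (κ (best false))
    ... | tri< _ _ _ = true
    ... | tri≈ _ _ _ = true
    ... | tri> _ _ _ = false

    b*-minimal : ∀ b → ¬ (κ (best b) ≺ κ (best b*))
    b*-minimal b with compare (κ (best true)) (κ (best false))
    b*-minimal true  | tri< _ _ _   = irrefl Eq.refl
    b*-minimal false | tri< _ _ t≯f = t≯f
    b*-minimal true  | tri≈ _ _ _   = irrefl Eq.refl
    b*-minimal false | tri≈ _ _ t≯f = t≯f
    b*-minimal true  | tri> t≮f _ _ = t≮f
    b*-minimal false | tri> _ _ _   = irrefl Eq.refl

    below-best : ∀ Y {X} → (∀ b → ¬ (κ (best b) ≺ κ X)) → ¬ (κ Y ≺ κ X)
    below-best Y best≮X Y<X =
      proj₂ (sub (Y zero)) (Y ∘ suc)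
        (≺-⊀-trans (<-respˡ-≈ (κ-cong (head-tail Y)) Y<X) (best≮X (Y zero)))

-- A row (or column) of the bipartite part of D: position x carries an arc unless it is blocked
-- or marked, and U selects the positions on the far side of the cut.

module Counting {r} (blocked U : Fin r → Bool) where

  Compatible Unique : (Fin r → Bool) → Set
  Compatible mark = ∀ x → mark x ≡ true → blocked x ≡ false
  Unique mark     = ∀ x y → mark x ≡ true → mark y ≡ true → x ≡ y

  avoiding hits : (Fin r → Bool) → ℤ
  avoiding mark = ∑[ x < r ] ⟦ not (blocked x ∨ mark x) ∧ U x ⟧
  hits mark     = ∑[ x < r ] ⟦ mark x ∧ U x ⟧

  avoiding-+-hits : ∀ {mark} → Compatible mark →
                    avoiding mark + hits mark ≡ ∑[ x < r ] ⟦ not (blocked x) ∧ U x ⟧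
  avoiding-+-hits {mark} compatible =
    trans (sym (∑-distrib-+ (λ x → ⟦ not (blocked x ∨ mark x) ∧ U x ⟧) (λ x → ⟦ mark x ∧ U x ⟧)))
          (sum-cong-≗ (λ x → split (compatible x)))
    where
    split : ∀ {x} → (mark x ≡ true → blocked x ≡ false) →
            ⟦ not (blocked x ∨ mark x) ∧ U x ⟧ + ⟦ mark x ∧ U x ⟧ ≡ ⟦ not (blocked x) ∧ U x ⟧
    split {x} compat with mark x
    ... | true  rewrite compat refl = ℤP.+-identityˡ _
    ... | false rewrite 𝔹.∨-identityʳ (blocked x) = ℤP.+-identityʳ _

  avoiding-≤ : ∀ {mark mark′} → Compatible mark → Compatible mark′ →
               avoiding mark′ ≤ avoiding mark + hits mark
  avoiding-≤ {mark} {mark′} compatible compatible′ = begin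
    avoiding mark′                  ≡⟨ ℤP.+-identityʳ (avoiding mark′) ⟨
    avoiding mark′ + 0ℤ             ≤⟨ ℤP.+-monoʳ-≤ (avoiding mark′) (0≤∑⟦⟧ (λ x → mark′ x ∧ U x)) ⟩
    avoiding mark′ + hits mark′     ≡⟨ avoiding-+-hits compatible′ ⟩
    ∑[ x < r ] ⟦ not (blocked x) ∧ U x ⟧ ≡⟨ avoiding-+-hits compatible ⟨
    avoiding mark + hits mark       ∎
    where open ℤP.≤-Reasoning

  hits-≤1 : ∀ {mark} → Unique mark → hits mark ≤ 1ℤ
  hits-≤1 {mark} unique = ∑-⟦⟧-≤1 (λ x → mark x ∧ U x)
    (λ x y hx hy → unique x y (𝔹.∧-conicalˡ _ _ hx) (𝔹.∧-conicalˡ _ _ hy))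

  hits-single : ∀ {mark q} → mark q ≡ true → Unique mark → hits mark ≡ ⟦ U q ⟧
  hits-single {mark} {q} mark-q unique = trans
    (∑-single _ q (λ x x≢q → cong (λ m → ⟦ m ∧ U x ⟧) (𝔹.¬-not (x≢q ∘ λ mark-x → unique x q mark-x mark-q))))
    (cong (λ m → ⟦ m ∧ U q ⟧) mark-q)

  avoiding-≤+1 : ∀ {mark mark′} → Compatible mark → Compatible mark′ → Unique mark →
                 avoiding mark′ ≤ avoiding mark + 1ℤ
  avoiding-≤+1 {mark} compatible compatible′ unique =
    ℤP.≤-trans (avoiding-≤ compatible compatible′) (ℤP.+-monoʳ-≤ (avoiding mark) (hits-≤1 unique))

  avoiding-≤-unmarked : ∀ {mark mark′} → Compatible mark → Compatible mark′ → (∀ x → mark x ≡ false) →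
                        avoiding mark′ ≤ avoiding mark
  avoiding-≤-unmarked {mark} {mark′} compatible compatible′ unmarked = subst (avoiding mark′ ≤_)
    (trans (cong (_+_ (avoiding mark)) (∑-zero (λ x → cong (λ y → ⟦ y ∧ U x ⟧) (unmarked x))))
           (ℤP.+-identityʳ _))
    (avoiding-≤ compatible compatible′)

  avoiding-tie : ∀ {mark mark′ p q} → Compatible mark → Compatible mark′ → Unique mark → Unique mark′ →
                 mark q ≡ true → mark′ p ≡ true → avoiding mark′ + ⟦ U p ⟧ ≡ avoiding mark + ⟦ U q ⟧
  avoiding-tie {mark} {mark′} {p} {q} compatible compatible′ unique unique′ mark-q mark′-p = begin
    avoiding mark′ + ⟦ U p ⟧     ≡⟨ cong (_+_ (avoiding mark′)) (hits-single mark′-p unique′) ⟨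
    avoiding mark′ + hits mark′  ≡⟨ avoiding-+-hits compatible′ ⟩
    ∑[ x < r ] ⟦ not (blocked x) ∧ U x ⟧ ≡⟨ avoiding-+-hits compatible ⟨
    avoiding mark + hits mark    ≡⟨ cong (_+_ (avoiding mark)) (hits-single mark-q unique) ⟩
    avoiding mark + ⟦ U q ⟧      ∎
    where open ≡-Reasoning

<ᵇ-true : ∀ {x y} → x ℕ.< y → (x ℕ.<ᵇ y) ≡ true
<ᵇ-true x<y = Equivalence.to 𝔹.T-≡ (ℕP.<⇒<ᵇ x<y)

<ᵇ-false : ∀ {x y} → y ℕ.≤ x → (x ℕ.<ᵇ y) ≡ false
<ᵇ-false {x} {y} y≤x = 𝔹.¬-not (λ x<ᵇy → ℕP.<⇒≱ (ℕP.<ᵇ⇒< x y (Equivalence.from 𝔹.T-≡ x<ᵇy)) y≤x)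

≤ᵇ≡not-<ᵇ : ∀ x y → (x ℕ.≤ᵇ y) ≡ not (y ℕ.<ᵇ x)
≤ᵇ≡not-<ᵇ x y with x ℕP.≤? y
... | yes x≤y = trans (Equivalence.to 𝔹.T-≡ (ℕP.≤⇒≤ᵇ x≤y)) (cong not (sym (<ᵇ-false x≤y)))
... | no  x≰y = trans (𝔹.¬-not (x≰y ∘ ℕP.≤ᵇ⇒≤ x y ∘ Equivalence.from 𝔹.T-≡))
                      (cong not (sym (<ᵇ-true (ℕP.≰⇒> x≰y))))

≡ᵇ-true : ∀ {x y} → x ≡ y → (x ℕ.≡ᵇ y) ≡ true
≡ᵇ-true {x} {y} x≡y = Equivalence.to 𝔹.T-≡ (ℕP.≡⇒≡ᵇ x y x≡y)

≡ᵇ-true⁻¹ : ∀ {x y} → (x ℕ.≡ᵇ y) ≡ true → x ≡ y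
≡ᵇ-true⁻¹ {x} {y} x≡ᵇy = ℕP.≡ᵇ⇒≡ x y (Equivalence.from 𝔹.T-≡ x≡ᵇy)

sumℤ-++ : ∀ {A : Set} (H : A → ℤ) xs ys → sumℤ (map H (xs ++ ys)) ≡ sumℤ (map H xs) + sumℤ (map H ys)
sumℤ-++ H []       ys = sym (ℤP.+-identityˡ _)
sumℤ-++ H (x ∷ xs) ys = trans (cong (_+_ (H x)) (sumℤ-++ H xs ys)) (sym (ℤP.+-assoc (H x) _ _))

sumℤ-tabulate : ∀ {A : Set} {r} (H : A → ℤ) (f : Fin r → A) → sumℤ (map H (tabulate f)) ≡ ∑[ i < r ] H (f i)
sumℤ-tabulate {r = zero}  H f = refl
sumℤ-tabulate {r = suc r} H f = cong (_+_ (H (f zero))) (sumℤ-tabulate H (f ∘ suc))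

ix-injective : ∀ {p} {i j : Fin p} → ix i ≡ ix j → i ≡ j
ix-injective = FinP.toℕ-injective ∘ ℕP.suc-injective

offset-< : ∀ {x y} d → x ℕ.< y → + x - d + 1ℤ ≤ + y - d
offset-< {x} {y} d x<y = begin
  + x - d + 1ℤ   ≡⟨ swap-last (+ x) (- d) 1ℤ ⟩
  + x + 1ℤ - d   ≤⟨ ℤP.+-monoˡ-≤ (- d) (ℤ.+≤+ (subst (ℕ._≤ y) (ℕP.+-comm 1 x) x<y)) ⟩
  + y - d        ∎
  where
  open ℤP.≤-Reasoning
  swap-last : ∀ x y z → x + y + z ≡ x + z + y
  swap-last = solve-∀

nonIncreasing-< : ∀ {p} {f : Fin p → ℕ} → NonIncreasing f → ∀ {i j} → f i ℕ.< f j → ix j ℕ.< ix i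
nonIncreasing-< f↓ {i} {j} fᵢ<fⱼ = ℕ.s≤s (ℕP.≰⇒> (λ i≤j → ℕP.<⇒≱ fᵢ<fⱼ (f↓ i j i≤j)))

-- The network N(d_A, d_B, ν, k)

module Network {n m : ℕ} (a : Fin n → ℕ) (b : Fin m → ℕ) (ν k : ℕ) where

  -- inV₂ i and inW₂ j say that v_i and w_j lie in the second blocks {v_{k+1},…,v_n} and
  -- {w_{ν-k+1},…,w_m}; the arc v_i w_j is missing iff both hold or i + j = ν + 1.
  inV₂ : Fin n → Bool
  inV₂ i = k ℕ.<ᵇ ix i

  inW₂ : Fin m → Bool
  inW₂ j = (ν ∸ k) ℕ.<ᵇ ix j

  antidiag : Fin n → Fin m → Bool
  antidiag i j = (ix i ℕ.+ ix j) ℕ.≡ᵇ suc ν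

  adjacent : Fin n → Fin m → Bool
  adjacent i j = arc ν k (v i) (w j)

  ca : Fin n → ℤ
  ca i = cap a b ν k s (v i)

  cb : Fin m → ℤ
  cb j = cap a b ν k (w j) t

  fromSource : (Fin n → Bool) → ℤ
  fromSource S = ∑[ i < n ] (if S i then 0ℤ else ca i)

  intoSink : (Fin m → Bool) → ℤ
  intoSink T = ∑[ j < m ] (if T j then cb j else 0ℤ)

  capacity : (Fin n → Bool) → (Fin m → Bool) → ℤ
  capacity S T = fromSource S + ∑[ i < n ] ∑[ j < m ] ⟦ adjacent i j ∧ (S i ∧ not (T j)) ⟧ + intoSink T

  cutOf : (Fin n → Bool) → (Fin m → Bool) → V n m → Bool
  cutOf S T s     = true
  cutOf S T (v i) = S i
  cutOf S T (w j) = T j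
  cutOf S T t     = false

  cutCap-cong : ∀ {X Y : V n m → Bool} → X ≗ Y → cutCap a b ν k X ≡ cutCap a b ν k Y
  cutCap-cong X≗Y = cong sumℤ (ListP.map-cong (λ x → cong sumℤ (ListP.map-cong (λ y →
    cong₂ (λ p q → if arc ν k x y ∧ p ∧ not q then cap a b ν k x y else 0ℤ) (X≗Y x) (X≗Y y))
    (vertices n m))) (vertices n m))

  st-set≗cutOf : ∀ {X} → IsSTSet X → X ≗ cutOf (X ∘ v) (X ∘ w)
  st-set≗cutOf (Xs , Xt) s     = Xs
  st-set≗cutOf (Xs , Xt) (v i) = refl
  st-set≗cutOf (Xs , Xt) (w j) = refl
  st-set≗cutOf (Xs , Xt) t     = Xt

  sumℤ-vertices : (H : V n m → ℤ) →
    sumℤ (map H (vertices n m)) ≡ H s + (∑[ i < n ] H (v i) + (∑[ j < m ] H (w j) + H t))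
  sumℤ-vertices H = cong (_+_ (H s)) (begin
    sumℤ (map H (map v (allFin n) ++ (map w (allFin m) ++ t ∷ [])))
      ≡⟨ sumℤ-++ H (map v (allFin n)) _ ⟩
    sumℤ (map H (map v (allFin n))) + sumℤ (map H (map w (allFin m) ++ t ∷ []))
      ≡⟨ cong₂ _+_ (along v)
                   (trans (sumℤ-++ H (map w (allFin m)) _) (cong₂ _+_ (along w) (ℤP.+-identityʳ (H t)))) ⟩
    ∑[ i < n ] H (v i) + (∑[ j < m ] H (w j) + H t) ∎)
    where
    open ≡-Reasoning
    along : ∀ {p} (f : Fin p → V n m) → sumℤ (map H (map f (allFin p))) ≡ ∑[ i < p ] H (f i)
    along {p} f = trans (cong sumℤ (sym (ListP.map-∘ (allFin p)))) (sumℤ-tabulate (H ∘ f) id)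

  cutCap-cutOf : ∀ S T → cutCap a b ν k (cutOf S T) ≡ capacity S T
  cutCap-cutOf S T = begin
    cutCap a b ν k (cutOf S T)
      ≡⟨ sumℤ-vertices row ⟩
    row s + (∑[ i < n ] row (v i) + (∑[ j < m ] row (w j) + row t))
      ≡⟨ cong₂ _+_ row-s (cong₂ _+_ (sum-cong-≗ row-v) (cong₂ _+_ (sum-cong-≗ row-w) row-t)) ⟩
    fromSource S + (middle + (intoSink T + 0ℤ))
      ≡⟨ reassoc (fromSource S) middle (intoSink T) ⟩
    capacity S T ∎
    where
    open ≡-Reasoning
    X : V n m → Bool
    X = cutOf S T
    entry : V n m → V n m → ℤ
    entry x y = if arc ν k x y ∧ X x ∧ not (X y) then cap a b ν k x y else 0ℤ
    row : V n m → ℤ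
    row x = sumℤ (map (entry x) (vertices n m))
    middle : ℤ
    middle = ∑[ i < n ] ∑[ j < m ] ⟦ adjacent i j ∧ (S i ∧ not (T j)) ⟧
    zeros : ∀ p → ∑[ _ < p ] 0ℤ ≡ 0ℤ
    zeros p = ∑-zero {p} (λ _ → refl)
    reassoc : ∀ x y z → x + (y + (z + 0ℤ)) ≡ x + y + z
    reassoc = solve-∀
    0+[x+[0+0]]≡x : ∀ x → 0ℤ + (x + (0ℤ + 0ℤ)) ≡ x
    0+[x+[0+0]]≡x = solve-∀
    0+[0+[x+0]]≡x : ∀ x → 0ℤ + (0ℤ + (x + 0ℤ)) ≡ x
    0+[0+[x+0]]≡x = solve-∀
    0+[0+[0+x]]≡x : ∀ x → 0ℤ + (0ℤ + (0ℤ + x)) ≡ x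
    0+[0+[0+x]]≡x = solve-∀
    row-s : row s ≡ fromSource S
    row-s = begin
      row s                                    ≡⟨ sumℤ-vertices (entry s) ⟩
      0ℤ + (r + (∑[ _ < m ] 0ℤ + 0ℤ))          ≡⟨ cong (λ z → 0ℤ + (r + (z + 0ℤ))) (zeros m) ⟩
      0ℤ + (r + (0ℤ + 0ℤ))                     ≡⟨ 0+[x+[0+0]]≡x r ⟩
      r                                        ≡⟨ sum-cong-≗ (λ i → if-not (S i)) ⟩
      fromSource S                             ∎
      where
      r : ℤ
      r = ∑[ i < n ] (if not (S i) then ca i else 0ℤ)
      if-not : ∀ {i} x → (if not x then ca i else 0ℤ) ≡ (if x then 0ℤ else ca i)
      if-not true  = refl
      if-not false = refl
    row-v : ∀ i → row (v i) ≡ ∑[ j < m ] ⟦ adjacent i j ∧ (S i ∧ not (T j)) ⟧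
    row-v i = begin
      row (v i)                  ≡⟨ sumℤ-vertices (entry (v i)) ⟩
      0ℤ + (∑[ _ < n ] 0ℤ + (r + 0ℤ)) ≡⟨ cong (λ z → 0ℤ + (z + (r + 0ℤ))) (zeros n) ⟩
      0ℤ + (0ℤ + (r + 0ℤ))       ≡⟨ 0+[0+[x+0]]≡x r ⟩
      r                          ∎
      where
      r : ℤ
      r = ∑[ j < m ] ⟦ adjacent i j ∧ (S i ∧ not (T j)) ⟧
    row-w : ∀ j → row (w j) ≡ (if T j then cb j else 0ℤ)
    row-w j = begin
      row (w j)                                  ≡⟨ sumℤ-vertices (entry (w j)) ⟩
      0ℤ + (∑[ _ < n ] 0ℤ + (∑[ _ < m ] 0ℤ + r)) ≡⟨ cong₂ (λ y z → 0ℤ + (y + (z + r))) (zeros n) (zeros m) ⟩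
      0ℤ + (0ℤ + (0ℤ + r))                       ≡⟨ 0+[0+[0+x]]≡x r ⟩
      r                                          ≡⟨ cong (λ x → if x then cb j else 0ℤ) (𝔹.∧-identityʳ (T j)) ⟩
      (if T j then cb j else 0ℤ)                 ∎
      where
      r : ℤ
      r = if T j ∧ true then cb j else 0ℤ
    row-t : row t ≡ 0ℤ
    row-t = trans (sumℤ-vertices (entry t)) (cong₂ (λ y z → 0ℤ + (y + (z + 0ℤ))) (zeros n) (zeros m))

  arcsOut : (Fin m → Bool) → Fin n → ℤ
  arcsOut T i = ∑[ j < m ] ⟦ adjacent i j ∧ not (T j) ⟧

  arcsIn : (Fin n → Bool) → Fin m → ℤ
  arcsIn S j = ∑[ i < n ] ⟦ adjacent i j ∧ S i ⟧

  capV : (Fin m → Bool) → Bool → Fin n → ℤ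
  capV T x i = if x then arcsOut T i else ca i

  capW : (Fin n → Bool) → Bool → Fin m → ℤ
  capW S x j = if x then cb j else arcsIn S j

  capacity-byV : ∀ S T → capacity S T ≡ ∑[ i < n ] capV T (S i) i + intoSink T
  capacity-byV S T = cong (_+ intoSink T)
    (trans (sym (∑-distrib-+ (λ i → if S i then 0ℤ else ca i)
                             (λ i → ∑[ j < m ] ⟦ adjacent i j ∧ (S i ∧ not (T j)) ⟧)))
           (sum-cong-≗ (λ i → row i (S i) refl)))
    where
    row : ∀ i x → S i ≡ x →
          (if S i then 0ℤ else ca i) + ∑[ j < m ] ⟦ adjacent i j ∧ (S i ∧ not (T j)) ⟧ ≡ capV T x i
    row i true  Sᵢ rewrite Sᵢ = ℤP.+-identityˡ (arcsOut T i)
    row i false Sᵢ   = begin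
      (if S i then 0ℤ else ca i) + ∑[ j < m ] ⟦ adjacent i j ∧ (S i ∧ not (T j)) ⟧
        ≡⟨ cong (λ x → (if x then 0ℤ else ca i) + ∑[ j < m ] ⟦ adjacent i j ∧ (x ∧ not (T j)) ⟧) Sᵢ ⟩
      ca i + ∑[ j < m ] ⟦ adjacent i j ∧ false ⟧
        ≡⟨ cong (_+_ (ca i)) (∑-zero (λ j → cong ⟦_⟧ (𝔹.∧-zeroʳ (adjacent i j)))) ⟩
      ca i + 0ℤ
        ≡⟨ ℤP.+-identityʳ (ca i) ⟩
      ca i ∎
      where open ≡-Reasoning

  capacity-byW : ∀ S T → capacity S T ≡ ∑[ j < m ] capW S (T j) j + fromSource S
  capacity-byW S T = begin
    fromSource S + ∑[ i < n ] ∑[ j < m ] cross i j + intoSink T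
      ≡⟨ cong (λ x → fromSource S + x + intoSink T) (∑-comm cross) ⟩
    fromSource S + ∑[ j < m ] ∑[ i < n ] cross i j + intoSink T
      ≡⟨ rotate (fromSource S) _ (intoSink T) ⟩
    ∑[ j < m ] ∑[ i < n ] cross i j + intoSink T + fromSource S
      ≡⟨ cong (_+ fromSource S) (∑-distrib-+ (λ j → ∑[ i < n ] cross i j) (λ j → if T j then cb j else 0ℤ)) ⟨
    ∑[ j < m ] (∑[ i < n ] cross i j + (if T j then cb j else 0ℤ)) + fromSource S
      ≡⟨ cong (_+ fromSource S) (sum-cong-≗ (λ j → column j (T j) refl)) ⟩
    ∑[ j < m ] capW S (T j) j + fromSource S
      ∎
    where
    open ≡-Reasoning
    cross : Fin n → Fin m → ℤ
    cross i j = ⟦ adjacent i j ∧ (S i ∧ not (T j)) ⟧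
    rotate : ∀ x y z → x + y + z ≡ y + z + x
    rotate = solve-∀
    column : ∀ j x → T j ≡ x → ∑[ i < n ] cross i j + (if T j then cb j else 0ℤ) ≡ capW S x j
    column j true Tⱼ rewrite Tⱼ = trans (cong (_+ cb j) (∑-zero (λ i → no-arc i))) (ℤP.+-identityˡ (cb j))
      where
      no-arc : ∀ i → ⟦ adjacent i j ∧ (S i ∧ false) ⟧ ≡ 0ℤ
      no-arc i rewrite 𝔹.∧-zeroʳ (S i) | 𝔹.∧-zeroʳ (adjacent i j) = refl
    column j false Tⱼ rewrite Tⱼ =
      trans (ℤP.+-identityʳ _) (sum-cong-≗ (λ i → cong (λ y → ⟦ adjacent i j ∧ y ⟧) (𝔹.∧-identityʳ (S i))))

  capacity-additiveV : ∀ T → Additive (λ S → capacity S T) (capV T)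
  capacity-additiveV T =
    additive-+ {Ψ = λ S → ∑[ i < n ] capV T (S i) i} (intoSink T) (∑-additive (capV T)) (λ S → capacity-byV S T)

  capacity-additiveW : ∀ S → Additive (capacity S) (capW S)
  capacity-additiveW S =
    additive-+ {Ψ = λ T → ∑[ j < m ] capW S (T j) j} (fromSource S) (∑-additive (capW S)) (capacity-byW S)

  capacity-exchangeV : ∀ {S} T {i j} → S i ≡ true → S j ≡ false →
    capacity (exchange S i j) T + (arcsOut T i + ca j) ≡ capacity S T + (ca i + arcsOut T j)
  capacity-exchangeV T = exchange-additive {Ψ = λ S → capacity S T} (capacity-additiveV T)

  capacity-exchangeW : ∀ S {T} {p q} → T p ≡ true → T q ≡ false →
    capacity S (exchange T p q) + (cb p + arcsIn S q) ≡ capacity S T + (arcsIn S p + cb q)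
  capacity-exchangeW S = exchange-additive {Ψ = capacity S} (capacity-additiveW S)

  ca-block : ∀ i → ca i ≡ + a i - ⟦ not (inV₂ i) ⟧
  ca-block i rewrite ≤ᵇ≡not-<ᵇ (ix i) k with inV₂ i
  ... | true  = sym (ℤP.+-identityʳ (+ a i))
  ... | false = refl

  cb-block : ∀ j → cb j ≡ + b j - ⟦ not (inW₂ j) ⟧
  cb-block j rewrite ≤ᵇ≡not-<ᵇ (ix j) (ν ∸ k) with inW₂ j
  ... | true  = sym (ℤP.+-identityʳ (+ b j))
  ... | false = refl

  ca-< : ∀ {i j} → inV₂ i ≡ inV₂ j → a i ℕ.< a j → ca i + 1ℤ ≤ ca j
  ca-< {i} {j} same aᵢ<aⱼ rewrite ca-block i | ca-block j | same = offset-< ⟦ not (inV₂ j) ⟧ aᵢ<aⱼ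

  ca-≡ : ∀ {i j} → inV₂ i ≡ inV₂ j → a i ≡ a j → ca i ≡ ca j
  ca-≡ {i} {j} same aᵢ≡aⱼ rewrite ca-block i | ca-block j | same | aᵢ≡aⱼ = refl

  cb-< : ∀ {p q} → inW₂ p ≡ inW₂ q → b q ℕ.< b p → cb q + 1ℤ ≤ cb p
  cb-< {p} {q} same bq<bp rewrite cb-block p | cb-block q | same = offset-< ⟦ not (inW₂ q) ⟧ bq<bp

  cb-≡ : ∀ {p q} → inW₂ p ≡ inW₂ q → b p ≡ b q → cb p ≡ cb q
  cb-≡ {p} {q} same bp≡bq rewrite cb-block p | cb-block q | same | bp≡bq = refl

  antidiag-sum : ∀ {i j} → antidiag i j ≡ true → ix i ℕ.+ ix j ≡ suc ν
  antidiag-sum = ≡ᵇ-true⁻¹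

  antidiag-injˡ : ∀ {i i′ q} → antidiag i q ≡ true → antidiag i′ q ≡ true → i ≡ i′
  antidiag-injˡ {i} {i′} {q} d d′ =
    ix-injective (ℕP.+-cancelʳ-≡ (ix q) (ix i) (ix i′) (trans (antidiag-sum d) (sym (antidiag-sum d′))))

  antidiag-injʳ : ∀ {i q q′} → antidiag i q ≡ true → antidiag i q′ ≡ true → q ≡ q′
  antidiag-injʳ {i} {q} {q′} d d′ =
    ix-injective (ℕP.+-cancelˡ-≡ (ix i) (ix q) (ix q′) (trans (antidiag-sum d) (sym (antidiag-sum d′))))

  antidiag-opposite : ∀ {i j} → antidiag i j ≡ true → inW₂ j ≡ not (inV₂ i)
  antidiag-opposite {i} {j} d with ix i ℕP.≤? k
  ... | yes i≤k = trans (<ᵇ-true (ℕP.≤-<-trans (ℕP.∸-monoʳ-≤ ν i≤k) (ℕP.m<n+o⇒m∸n<o ν (ix i) ν<i+j)))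
                        (cong not (sym (<ᵇ-false i≤k)))
    where
    ν<i+j : ν ℕ.< ix i ℕ.+ ix j
    ν<i+j = subst (ν ℕ.<_) (sym (antidiag-sum d)) (ℕP.n<1+n ν)
  ... | no  i≰k = trans (<ᵇ-false (ℕP.m+n≤o⇒m≤o∸n (ix j) j+k≤ν)) (cong not (sym (<ᵇ-true k<i)))
    where
    k<i : k ℕ.< ix i
    k<i = ℕP.≰⇒> i≰k
    j+k≤ν : ix j ℕ.+ k ℕ.≤ ν
    j+k≤ν = ℕ.s≤s⁻¹ (begin
      suc (ix j ℕ.+ k)   ≡⟨ ℕP.+-suc (ix j) k ⟨
      ix j ℕ.+ suc k     ≤⟨ ℕP.+-monoʳ-≤ (ix j) k<i ⟩
      ix j ℕ.+ ix i      ≡⟨ ℕP.+-comm (ix j) (ix i) ⟩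
      ix i ℕ.+ ix j      ≡⟨ antidiag-sum d ⟩
      suc ν              ∎)
      where open ℕP.≤-Reasoning

  antidiag-unblocked : ∀ {i j} → antidiag i j ≡ true → inV₂ i ∧ inW₂ j ≡ false
  antidiag-unblocked {i} d = trans (cong (inV₂ i ∧_) (antidiag-opposite d)) (𝔹.∧-inverseʳ (inV₂ i))

  antidiag-beyond : ∀ {i} j → ν ℕ.< ix i → antidiag i j ≡ false
  antidiag-beyond {i} j ν<i = 𝔹.¬-not (λ d → ℕP.<-irrefl (sym (antidiag-sum d))
    (ℕP.≤-<-trans ν<i (ℕP.m<m+n (ix i) (ℕ.s≤s ℕ.z≤n))))

  antidiag-partner : ν ℕ.≤ m → ∀ {i} → ix i ℕ.≤ ν → Σ[ q ∈ Fin m ] antidiag i q ≡ true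
  antidiag-partner ν≤m {i} i≤ν = q , ≡ᵇ-true (begin
      ix i ℕ.+ ix q               ≡⟨ cong (λ x → ix i ℕ.+ suc x) (FinP.toℕ-fromℕ< ν∸i<m) ⟩
      ix i ℕ.+ suc (ν ∸ ix i)     ≡⟨ ℕP.+-suc (ix i) (ν ∸ ix i) ⟩
      suc (ix i ℕ.+ (ν ∸ ix i))   ≡⟨ cong suc (ℕP.m+[n∸m]≡n i≤ν) ⟩
      suc ν                       ∎)
    where
    open ≡-Reasoning
    ν∸i<m : ν ∸ ix i ℕ.< m
    ν∸i<m = ℕP.<-≤-trans (ℕP.∸-monoʳ-< (ℕ.s≤s ℕ.z≤n) i≤ν) ν≤m
    q : Fin m
    q = fromℕ< ν∸i<m

  antidiag-antitone : ∀ {i j p q} → antidiag i q ≡ true → antidiag j p ≡ true → ix i ℕ.< ix j → ix p ℕ.< ix q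
  antidiag-antitone {i} {j} {p} {q} dᵢ dⱼ i<j = ℕP.≰⇒> (λ q≤p → ℕP.<-irrefl refl (begin-strict
    suc ν           ≡⟨ antidiag-sum dᵢ ⟨
    ix i ℕ.+ ix q   <⟨ ℕP.+-mono-<-≤ i<j q≤p ⟩
    ix j ℕ.+ ix p   ≡⟨ antidiag-sum dⱼ ⟩
    suc ν           ∎))
    where open ℕP.≤-Reasoning

  private
    module Row (T : Fin m → Bool) (g : Bool) = Counting (λ j → g ∧ inW₂ j) (not ∘ T)
    module Column (S : Fin n → Bool) (h : Bool) = Counting (λ i → inV₂ i ∧ h) S

  module _ (T : Fin m → Bool) {i j : Fin n} (same : inV₂ i ≡ inV₂ j) where

    private
      arcsOut-j : arcsOut T j ≡ Row.avoiding T (inV₂ i) (antidiag j)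
      arcsOut-j = cong (λ g → Row.avoiding T g (antidiag j)) (sym same)

      compatible-i : Row.Compatible T (inV₂ i) (antidiag i)
      compatible-i _ = antidiag-unblocked

      compatible-j : Row.Compatible T (inV₂ i) (antidiag j)
      compatible-j y d = trans (cong (_∧ inW₂ y) same) (antidiag-unblocked d)

      unique-i : Row.Unique T (inV₂ i) (antidiag i)
      unique-i _ _ = antidiag-injʳ {i}

    arcsOut-≤+1 : arcsOut T j ≤ arcsOut T i + 1ℤ
    arcsOut-≤+1 = subst (_≤ arcsOut T i + 1ℤ) (sym arcsOut-j) (Row.avoiding-≤+1 T _ compatible-i compatible-j unique-i)

    arcsOut-≤-beyond : ν ℕ.< ix i → arcsOut T j ≤ arcsOut T i
    arcsOut-≤-beyond ν<i = subst (_≤ arcsOut T i) (sym arcsOut-j)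
      (Row.avoiding-≤-unmarked T _ compatible-i compatible-j (λ y → antidiag-beyond y ν<i))

    arcsOut-tie : ∀ {p q} → antidiag i q ≡ true → antidiag j p ≡ true →
                  arcsOut T j + ⟦ not (T p) ⟧ ≡ arcsOut T i + ⟦ not (T q) ⟧
    arcsOut-tie dᵢ dⱼ = trans (cong (_+ _) arcsOut-j)
      (Row.avoiding-tie T _ compatible-i compatible-j unique-i (λ _ _ → antidiag-injʳ {j}) dᵢ dⱼ)

  module _ (S : Fin n → Bool) {p q : Fin m} (same : inW₂ p ≡ inW₂ q) where

    private
      arcsIn-p : arcsIn S p ≡ Column.avoiding S (inW₂ q) (λ i → antidiag i p)
      arcsIn-p = cong (λ h → Column.avoiding S h (λ i → antidiag i p)) same

      compatible-q : Column.Compatible S (inW₂ q) (λ i → antidiag i q)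
      compatible-q _ = antidiag-unblocked

      compatible-p : Column.Compatible S (inW₂ q) (λ i → antidiag i p)
      compatible-p x d = trans (cong (inV₂ x ∧_) (sym same)) (antidiag-unblocked d)

      unique-q : Column.Unique S (inW₂ q) (λ i → antidiag i q)
      unique-q _ _ = antidiag-injˡ {q = q}

    arcsIn-≤+1 : arcsIn S p ≤ arcsIn S q + 1ℤ
    arcsIn-≤+1 = subst (_≤ arcsIn S q + 1ℤ) (sym arcsIn-p) (Column.avoiding-≤+1 S _ compatible-q compatible-p unique-q)

    arcsIn-tie : ∀ {i j} → antidiag i q ≡ true → antidiag j p ≡ true →
                 arcsIn S p + ⟦ S j ⟧ ≡ arcsIn S q + ⟦ S i ⟧
    arcsIn-tie dᵢ dⱼ = trans (cong (_+ _) arcsIn-p)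
      (Column.avoiding-tie S _ compatible-q compatible-p unique-q (λ _ _ → antidiag-injˡ {q = p}) dᵢ dⱼ)

  -- Φ S counts the v_i of the second block on the wrong side of ν: in S with i ≤ ν, or outside S
  -- with i > ν. It settles a tie a_i = a_j with i ≤ ν < j: one of dropping v_i and adding v_j
  -- does not increase the capacity, and both lower Φ.
  φ : Bool → Fin n → ℤ
  φ x i = ⟦ inV₂ i ∧ (x xor (ν ℕ.<ᵇ ix i)) ⟧

  Φ : (Fin n → Bool) → ℤ
  Φ S = ∑[ i < n ] φ (S i) i

  potential : (Fin n → Bool) → (Fin m → Bool) → Vec ℤ 5
  potential S T = capacity S T ∷ Φ S ∷ ∑∉ S a ∷ ∑∉ S ix ∷ ∑∉ T ix ∷ []

  _≺_ : Vec ℤ 5 → Vec ℤ 5 → Set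
  _≺_ = Lex-< _≡_ _<_

  Improvable : (Fin n → Bool) → (Fin m → Bool) → Set
  Improvable S T = Σ[ S′ ∈ (Fin n → Bool) ] Σ[ T′ ∈ (Fin m → Bool) ] potential S′ T′ ≺ potential S T

  potential-cong : ∀ {S S′ T T′} → S ≗ S′ → T ≗ T′ → potential S T ≡ potential S′ T′
  potential-cong {S} {S′} {T} {T′} S≗S′ T≗T′ =
    cong₂ _∷_ capacity≡ (cong₂ _∷_ (sum-cong-≗ (λ i → cong (λ x → φ x i) (S≗S′ i)))
      (cong₂ _∷_ (∑∉-cong S≗S′ a) (cong₂ _∷_ (∑∉-cong S≗S′ ix) (cong₂ _∷_ (∑∉-cong T≗T′ ix) refl))))
    where
    ∑∉-cong : ∀ {r} {U U′ : Fin r → Bool} → U ≗ U′ → ∀ f → ∑∉ U f ≡ ∑∉ U′ f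
    ∑∉-cong U≗U′ f = sum-cong-≗ (λ i → cong (λ x → outside f x i) (U≗U′ i))
    capacity≡ : capacity S T ≡ capacity S′ T′
    capacity≡ = cong₂ _+_ (cong₂ _+_
      (sum-cong-≗ (λ i → cong (λ x → if x then 0ℤ else ca i) (S≗S′ i)))
      (sum-cong-≗ (λ i → sum-cong-≗ (λ j →
        cong₂ (λ x y → ⟦ adjacent i j ∧ (x ∧ not y) ⟧) (S≗S′ i) (T≗T′ j)))))
      (sum-cong-≗ (λ j → cong (λ x → if x then cb j else 0ℤ) (T≗T′ j)))

  module _ (S : Fin n → Bool) {T : Fin m → Bool} {p q : Fin m}
           (Tₚ : T p ≡ true) (Tq : T q ≡ false) (same : inW₂ p ≡ inW₂ q) where

    improve-lighter : b q ℕ.< b p → ix p ℕ.< ix q → Improvable S T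
    improve-lighter bq<bp p<q = S , exchange T p q ,
      ≤-then (≤-balance (capacity-exchangeW S Tₚ Tq) gap)
             (λ _ → next refl (next refl (next refl (this (∑∉-exchange-< T ix Tₚ Tq p<q) refl))))
      where
      gap : arcsIn S p + cb q ≤ cb p + arcsIn S q
      gap = subst₂ _≤_ (ℤP.+-comm (cb q) (arcsIn S p)) (ℤP.+-comm (arcsIn S q) (cb p))
                   (cross-≤ {x = arcsIn S q} {u = cb q} (arcsIn-≤+1 S same) (cb-< same bq<bp))

  module _ {S : Fin n → Bool} (T : Fin m → Bool) {i j : Fin n}
           (Sᵢ : S i ≡ true) (Sⱼ : S j ≡ false) (same : inV₂ i ≡ inV₂ j) where

    private
      S′ : Fin n → Bool
      S′ = exchange S i j

      capacity-step : capacity S′ T + (arcsOut T i + ca j) ≡ capacity S T + (ca i + arcsOut T j)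
      capacity-step = capacity-exchangeV T Sᵢ Sⱼ

      Φ-exchange : (ν ℕ.<ᵇ ix i) ≡ (ν ℕ.<ᵇ ix j) → Φ S′ ≡ Φ S
      Φ-exchange same-side = exchange-invariant {Ψ = Φ} (∑-additive φ) Sᵢ Sⱼ
        (λ x → cong₂ (λ g c → ⟦ g ∧ (x xor c) ⟧) same same-side)

      flip-capacity : ∀ {x c} → S x ≡ c →
                        capacity (updateAt S x (const (not c))) T + capV T c x ≡ capacity S T + capV T (not c) x
      flip-capacity {x} refl = capacity-additiveV T S x _

      flip-Φ : ∀ {x c} → S x ≡ c → Φ (updateAt S x (const (not c))) + φ c x ≡ Φ S + φ (not c) x
      flip-Φ {x} refl = ∑-additive φ S x _

      φ-in-V₂ : ∀ x {y} → inV₂ y ≡ true → φ x y ≡ ⟦ x xor (ν ℕ.<ᵇ ix y) ⟧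
      φ-in-V₂ x {y} inV₂y = cong (λ g → ⟦ g ∧ (x xor (ν ℕ.<ᵇ ix y)) ⟧) inV₂y

      φ-drop : inV₂ i ≡ true → ix i ℕ.≤ ν → φ false i < φ true i
      φ-drop inV₂ᵢ i≤ν rewrite φ-in-V₂ false inV₂ᵢ | φ-in-V₂ true inV₂ᵢ | <ᵇ-false {ν} i≤ν = ℤ.+<+ ℕP.0<1+n

      φ-add : inV₂ j ≡ true → ν ℕ.< ix j → φ true j < φ false j
      φ-add inV₂ⱼ ν<j rewrite φ-in-V₂ false inV₂ⱼ | φ-in-V₂ true inV₂ⱼ | <ᵇ-true ν<j = ℤ.+<+ ℕP.0<1+n

      capacity-tie : a i ≡ a j → arcsOut T j ≤ arcsOut T i → capacity S′ T ≤ capacity S T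
      capacity-tie aᵢ≡aⱼ Nⱼ≤Nᵢ = ≤-balance capacity-step (begin
        ca i + arcsOut T j    ≡⟨ cong (_+ arcsOut T j) (ca-≡ same aᵢ≡aⱼ) ⟩
        ca j + arcsOut T j    ≤⟨ ℤP.+-monoʳ-≤ (ca j) Nⱼ≤Nᵢ ⟩
        ca j + arcsOut T i    ≡⟨ ℤP.+-comm (ca j) (arcsOut T i) ⟩
        arcsOut T i + ca j    ∎)
        where open ℤP.≤-Reasoning

    improve-heavier : a i ℕ.< a j → ix j ℕ.< ix i → Improvable S T
    improve-heavier aᵢ<aⱼ j<i with ν ℕP.<? ix i
    ... | yes ν<i = S′ , T ,
      this (<-balance capacity-step
             (cross-< {x = arcsOut T i} {u = ca i} (arcsOut-≤-beyond T same ν<i) (ca-< same aᵢ<aⱼ))) refl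
    ... | no  ν≮i = S′ , T ,
      ≤-then (≤-balance capacity-step (cross-≤ {x = arcsOut T i} {u = ca i} (arcsOut-≤+1 T same) (ca-< same aᵢ<aⱼ)))
             (λ _ → next (Φ-exchange same-side) (this (∑∉-exchange-< S a Sᵢ Sⱼ aᵢ<aⱼ) refl))
      where
      same-side : (ν ℕ.<ᵇ ix i) ≡ (ν ℕ.<ᵇ ix j)
      same-side = trans (<ᵇ-false (ℕP.≮⇒≥ ν≮i)) (sym (<ᵇ-false (ℕP.≤-trans (ℕP.<⇒≤ j<i) (ℕP.≮⇒≥ ν≮i))))

    improve-tie : a i ≡ a j → ix i ℕ.< ix j → (ν ℕ.<ᵇ ix i) ≡ (ν ℕ.<ᵇ ix j) →
                  ∀ {T′} → capacity (exchange S i j) T′ ≤ capacity S T →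
                  potential (exchange S i j) T′ ≺ potential S T
    improve-tie aᵢ≡aⱼ i<j same-side capacity≤ = ≤-then capacity≤ (λ _ → next (Φ-exchange same-side)
      (next (∑∉-exchange-≡ S a Sᵢ Sⱼ aᵢ≡aⱼ) (this (∑∉-exchange-< S ix Sᵢ Sⱼ i<j) refl)))

    improve-tie-beyond : a i ≡ a j → ix i ℕ.< ix j → ν ℕ.< ix i → Improvable S T
    improve-tie-beyond aᵢ≡aⱼ i<j ν<i = S′ , T ,
      improve-tie aᵢ≡aⱼ i<j (trans (<ᵇ-true ν<i) (sym (<ᵇ-true (ℕP.<-trans ν<i i<j))))
                  (capacity-tie aᵢ≡aⱼ (arcsOut-≤-beyond T same ν<i))

    improve-straddle : inV₂ i ≡ true → a i ≡ a j → ix i ℕ.≤ ν → ν ℕ.< ix j → Improvable S T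
    improve-straddle inV₂ᵢ aᵢ≡aⱼ i≤ν ν<j with ca i ℤP.≤? arcsOut T i
    ... | yes cᵢ≤Nᵢ = updateAt S i (const false) , T ,
      ≤-then (≤-balance (flip-capacity Sᵢ) cᵢ≤Nᵢ) (λ _ → this (<-balance (flip-Φ Sᵢ) (φ-drop inV₂ᵢ i≤ν)) refl)
    ... | no  cᵢ≰Nᵢ = updateAt S j (const true) , T ,
      ≤-then (≤-balance (flip-capacity Sⱼ) Nⱼ≤cⱼ)
             (λ _ → this (<-balance (flip-Φ Sⱼ) (φ-add (trans (sym same) inV₂ᵢ) ν<j)) refl)
      where
      Nⱼ≤cⱼ : arcsOut T j ≤ ca j
      Nⱼ≤cⱼ = begin
        arcsOut T j         ≤⟨ arcsOut-≤+1 T same ⟩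
        arcsOut T i + 1ℤ    ≡⟨ ℤP.+-comm (arcsOut T i) 1ℤ ⟩
        1ℤ + arcsOut T i    ≤⟨ ℤP.i<j⇒suc[i]≤j (ℤP.≰⇒> cᵢ≰Nᵢ) ⟩
        ca i                ≡⟨ ca-≡ same aᵢ≡aⱼ ⟩
        ca j                ∎
        where open ℤP.≤-Reasoning

    improve-tie-partnered : NonIncreasing b → ν ℕ.≤ m → a i ≡ a j → ix i ℕ.< ix j → ix j ℕ.≤ ν → Improvable S T
    improve-tie-partnered b↓ ν≤m aᵢ≡aⱼ i<j j≤ν = by-partners (T q) (T p) refl refl
      where
      i≤ν : ix i ℕ.≤ ν
      i≤ν = ℕP.≤-trans (ℕP.<⇒≤ i<j) j≤ν

      q p : Fin m
      q = proj₁ (antidiag-partner ν≤m i≤ν)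
      p = proj₁ (antidiag-partner ν≤m j≤ν)

      dᵢ : antidiag i q ≡ true
      dᵢ = proj₂ (antidiag-partner ν≤m i≤ν)
      dⱼ : antidiag j p ≡ true
      dⱼ = proj₂ (antidiag-partner ν≤m j≤ν)

      same-W : inW₂ p ≡ inW₂ q
      same-W = trans (antidiag-opposite dⱼ) (trans (cong not (sym same)) (sym (antidiag-opposite dᵢ)))

      same-side : (ν ℕ.<ᵇ ix i) ≡ (ν ℕ.<ᵇ ix j)
      same-side = trans (<ᵇ-false i≤ν) (sym (<ᵇ-false j≤ν))

      tie : arcsOut T j + ⟦ not (T p) ⟧ ≡ arcsOut T i + ⟦ not (T q) ⟧
      tie = arcsOut-tie T same dᵢ dⱼ

      single : arcsOut T j ≤ arcsOut T i → Improvable S T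
      single Nⱼ≤Nᵢ = S′ , T , improve-tie aᵢ≡aⱼ i<j same-side (capacity-tie aᵢ≡aⱼ Nⱼ≤Nᵢ)

      -- Putting v_j into S instead of v_i adds the cut arc v_j w_q; exchanging w_p and w_q as well
      -- removes it again, at no cost since b_p = b_q.
      double : T p ≡ true → T q ≡ false → b p ≡ b q → Improvable S T
      double Tₚ Tq bp≡bq = S′ , exchange T p q , improve-tie aᵢ≡aⱼ i<j same-side (ℤP.≤-reflexive (begin
          capacity S′ (exchange T p q)   ≡⟨ step-W ⟩
          capacity S′ T + -1ℤ            ≡⟨ cong (_+ -1ℤ) step-V ⟩
          capacity S T + 1ℤ + -1ℤ        ≡⟨ x+1-1≡x (capacity S T) ⟩
          capacity S T                   ∎))
        where
        open ≡-Reasoning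
        x+1-1≡x : ∀ x → x + 1ℤ + -1ℤ ≡ x
        x+1-1≡x = solve-∀
        shuffle : ∀ c x → c + (x + 1ℤ) ≡ x + c + 1ℤ
        shuffle = solve-∀
        shuffle′ : ∀ x c → x + c ≡ c + (x + 1ℤ) + -1ℤ
        shuffle′ = solve-∀

        Nⱼ≡Nᵢ+1 : arcsOut T j ≡ arcsOut T i + 1ℤ
        Nⱼ≡Nᵢ+1 = trans (sym (ℤP.+-identityʳ (arcsOut T j)))
          (subst₂ (λ x y → arcsOut T j + ⟦ not x ⟧ ≡ arcsOut T i + ⟦ not y ⟧) Tₚ Tq tie)

        Mp+1≡Mq : arcsIn S′ p + 1ℤ ≡ arcsIn S′ q
        Mp+1≡Mq = trans
          (subst₂ (λ x y → arcsIn S′ p + ⟦ x ⟧ ≡ arcsIn S′ q + ⟦ y ⟧)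
                  (exchange-in S i j) (exchange-out S (exchange-distinct Sᵢ Sⱼ)) (arcsIn-tie S′ same-W dᵢ dⱼ))
          (ℤP.+-identityʳ (arcsIn S′ q))

        arcsOut-shift : ca i + arcsOut T j ≡ arcsOut T i + ca j + 1ℤ
        arcsOut-shift = begin
          ca i + arcsOut T j            ≡⟨ cong₂ _+_ (ca-≡ same aᵢ≡aⱼ) Nⱼ≡Nᵢ+1 ⟩
          ca j + (arcsOut T i + 1ℤ)     ≡⟨ shuffle (ca j) (arcsOut T i) ⟩
          arcsOut T i + ca j + 1ℤ       ∎

        arcsIn-shift : arcsIn S′ p + cb q ≡ cb p + arcsIn S′ q + -1ℤ
        arcsIn-shift = begin
          arcsIn S′ p + cb q                   ≡⟨ cong (_+_ (arcsIn S′ p)) (cb-≡ same-W bp≡bq) ⟨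
          arcsIn S′ p + cb p                   ≡⟨ shuffle′ (arcsIn S′ p) (cb p) ⟩
          cb p + (arcsIn S′ p + 1ℤ) + -1ℤ      ≡⟨ cong (λ z → cb p + z + -1ℤ) Mp+1≡Mq ⟩
          cb p + arcsIn S′ q + -1ℤ             ∎

        step-V : capacity S′ T ≡ capacity S T + 1ℤ
        step-V = ≡-balance {y = capacity S T} capacity-step arcsOut-shift

        step-W : capacity S′ (exchange T p q) ≡ capacity S′ T + -1ℤ
        step-W = ≡-balance {y = capacity S′ T} (capacity-exchangeW S′ Tₚ Tq) arcsIn-shift

      by-partners : ∀ x y → T q ≡ x → T p ≡ y → Improvable S T
      by-partners true  _     Tq _  =
        single (≤-balance tie (subst (λ z → ⟦ not z ⟧ ≤ ⟦ not (T p) ⟧) (sym Tq) (0≤⟦⟧ (not (T p)))))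
      by-partners false false Tq Tₚ = single (≤-balance tie (ℤP.≤-reflexive (cong (⟦_⟧ ∘ not) (trans Tq (sym Tₚ)))))
      by-partners false true  Tq Tₚ with ℕP.<-cmp (b q) (b p)
      ... | tri< bq<bp _ _ = improve-lighter S Tₚ Tq same-W bq<bp (antidiag-antitone dᵢ dⱼ i<j)
      ... | tri≈ _ bq≡bp _ = double Tₚ Tq (sym bq≡bp)
      ... | tri> _ _ bp<bq =
        contradiction (b↓ p q (ℕP.<⇒≤ (ℕ.s≤s⁻¹ (antidiag-antitone dᵢ dⱼ i<j)))) (ℕP.<⇒≱ bp<bq)

-- Clean minimum cuts

module MinimalCut {n m : ℕ} (a : Fin n → ℕ) (b : Fin m → ℕ) (ν k : ℕ)
                  (a↓ : NonIncreasing a) (b↓ : NonIncreasing b) (k≤ν : k ℕ.≤ ν) (ν≤m : ν ℕ.≤ m) where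

  open Network a b ν k

  private
    jointPotential : (Fin (n ℕ.+ m) → Bool) → Vec ℤ 5
    jointPotential Z = potential (Z ∘ (_↑ˡ m)) (Z ∘ (n ↑ʳ_))

    join : (Fin n → Bool) → (Fin m → Bool) → Fin (n ℕ.+ m) → Bool
    join S T x = [ S , T ]′ (splitAt n x)

    minimum : Σ[ Z ∈ (Fin (n ℕ.+ m) → Bool) ] (∀ Y → ¬ (jointPotential Y ≺ jointPotential Z))
    minimum = minimiser (Lex.<-strictTotalOrder ℤP.<-strictTotalOrder 5) (n ℕ.+ m) jointPotential
      (λ Z≗Z′ → Pointwise.≡⇒Pointwise-≡ (potential-cong (Z≗Z′ ∘ (_↑ˡ m)) (Z≗Z′ ∘ (n ↑ʳ_))))

  S* : Fin n → Bool
  S* = proj₁ minimum ∘ (_↑ˡ m)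

  T* : Fin m → Bool
  T* = proj₁ minimum ∘ (n ↑ʳ_)

  unimprovable : ¬ Improvable S* T*
  unimprovable (S , T , better) = proj₂ minimum (join S T) (subst (_≺ potential S* T*) potential-join better)
    where
    potential-join : potential S T ≡ jointPotential (join S T)
    potential-join = potential-cong (λ i → sym (cong [ S , T ]′ (FinP.splitAt-↑ˡ n i m)))
                                    (λ j → sym (cong [ S , T ]′ (FinP.splitAt-↑ʳ n m j)))

  clean-V : ∀ {i j} → inV₂ i ≡ inV₂ j → S* i ≡ true → S* j ≡ false →
            (a j ℕ.≤ a i) × (a i ≡ a j → ix i ℕ.> ix j)
  clean-V {i} {j} same Sᵢ Sⱼ = a-ordered , index-ordered
    where
    a-ordered : a j ℕ.≤ a i
    a-ordered = ℕP.≮⇒≥ (λ aᵢ<aⱼ →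
      unimprovable (improve-heavier T* Sᵢ Sⱼ same aᵢ<aⱼ (nonIncreasing-< a↓ aᵢ<aⱼ)))

    tie : a i ≡ a j → ix i ℕ.< ix j → Improvable S* T*
    tie aᵢ≡aⱼ i<j with ix j ℕP.≤? ν | ix i ℕP.≤? ν
    ... | yes j≤ν | _       = improve-tie-partnered T* Sᵢ Sⱼ same b↓ ν≤m aᵢ≡aⱼ i<j j≤ν
    ... | no  j≰ν | yes i≤ν = improve-straddle T* Sᵢ Sⱼ same inV₂ᵢ aᵢ≡aⱼ i≤ν (ℕP.≰⇒> j≰ν)
      where
      inV₂ᵢ : inV₂ i ≡ true
      inV₂ᵢ = trans same (<ᵇ-true (ℕP.≤-<-trans k≤ν (ℕP.≰⇒> j≰ν)))
    ... | no  _   | no  i≰ν = improve-tie-beyond T* Sᵢ Sⱼ same aᵢ≡aⱼ i<j (ℕP.≰⇒> i≰ν)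

    index-ordered : a i ≡ a j → ix i ℕ.> ix j
    index-ordered aᵢ≡aⱼ = ℕP.≰⇒> (λ i≤j → unimprovable (tie aᵢ≡aⱼ
      (ℕP.≤∧≢⇒< i≤j (exchange-distinct Sᵢ Sⱼ ∘ ix-injective))))

  clean-W : ∀ {p q} → inW₂ p ≡ inW₂ q → T* p ≡ true → T* q ≡ false → b p ℕ.≤ b q
  clean-W same Tₚ Tq = ℕP.≮⇒≥ (λ bq<bp →
    unimprovable (improve-lighter S* Tₚ Tq same bq<bp (nonIncreasing-< b↓ bq<bp)))

  cut : V n m → Bool
  cut = cutOf S* T*

  cut-clean : Clean a b ν k cut
  cut-clean =
    (λ i j i≤k j≤k Sᵢ Sⱼ → clean-V (same-low i≤k j≤k) (T⇒true Sᵢ) (T-not⇒false Sⱼ)) ,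
    (λ p q p≤ q≤ Tₚ Tq → clean-W (same-low p≤ q≤) (T⇒true Tₚ) (T-not⇒false Tq)) ,
    (λ i j k<i k<j Sᵢ Sⱼ → clean-V (same-high k<i k<j) (T⇒true Sᵢ) (T-not⇒false Sⱼ)) ,
    (λ p q <p <q Tₚ Tq → clean-W (same-high <p <q) (T⇒true Tₚ) (T-not⇒false Tq))
    where
    T⇒true : ∀ {x} → Data.Bool.T x → x ≡ true
    T⇒true = Equivalence.to 𝔹.T-≡
    T-not⇒false : ∀ {x} → Data.Bool.T (not x) → x ≡ false
    T-not⇒false = Equivalence.to 𝔹.T-not-≡
    same-low : ∀ {c x y} → x ℕ.≤ c → y ℕ.≤ c → (c ℕ.<ᵇ x) ≡ (c ℕ.<ᵇ y)
    same-low x≤c y≤c = trans (<ᵇ-false x≤c) (sym (<ᵇ-false y≤c))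
    same-high : ∀ {c x y} → c ℕ.< x → c ℕ.< y → (c ℕ.<ᵇ x) ≡ (c ℕ.<ᵇ y)
    same-high c<x c<y = trans (<ᵇ-true c<x) (sym (<ᵇ-true c<y))

  cut-minimum : (Y : V n m → Bool) → IsSTSet Y → cutCap a b ν k cut ≤ cutCap a b ν k Y
  cut-minimum Y Y-st = begin
    cutCap a b ν k cut                          ≡⟨ cutCap-cutOf S* T* ⟩
    capacity S* T*                              ≤⟨ ℤP.≮⇒≥ (λ lt → unimprovable (Y ∘ v , Y ∘ w , this lt refl)) ⟩
    capacity (Y ∘ v) (Y ∘ w)                    ≡⟨ cutCap-cutOf (Y ∘ v) (Y ∘ w) ⟨
    cutCap a b ν k (cutOf (Y ∘ v) (Y ∘ w))      ≡⟨ cutCap-cong {X = Y} (st-set≗cutOf Y-st) ⟨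
    cutCap a b ν k Y                            ∎
    where open ℤP.≤-Reasoning

lemma3 : (n m : ℕ) (a : Fin n → ℕ) (b : Fin m → ℕ) (ν k : ℕ) →
    NonIncreasing a → NonIncreasing b →
    k ℕ.≤ ν → ν ℕ.≤ n → ν ℕ.≤ m →
    Σ (V n m → Bool) (λ X →
      IsSTSet X × Clean a b ν k X ×
      ((Y : V n m → Bool) → IsSTSet Y → cutCap a b ν k X ≤ cutCap a b ν k Y))
lemma3 n m a b ν k a↓ b↓ k≤ν _ ν≤m = cut , (refl , refl) , cut-clean , cut-minimum
  where open MinimalCut a b ν k a↓ b↓ k≤ν ν≤m
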